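{- Let $\mathbf{A}=(K,T,+,;,{}^*,\rightarrow,0,1)$ be a graded Kleene algebra with tests (GKAT) and $n\geq1$. Then $\mathbf{M}(n,\mathbf{A})=(M(n,K),\Delta(n,T),+,;,{}^*,\rightarrow,0_n,I_n)$ is a GKAT; and if $\mathbf{A}$ is an idempotent graded Kleene algebra with tests (I-GKAT), then $\mathbf{M}(n,\mathbf{A})$ is an I-GKAT.
   Context: A GKAT is a tuple $(K,T,+,;,{}^*,\rightarrow,0,1)$ where $K$ is a set, $T\subseteq K$, $0,1\in T$, $+$ and $;$ are binary operations on $K$ under which $T$ is closed, ${}^*$ is unary on $K$, and $\rightarrow$ is a binary operation on $T$ with values in $T$, such that for all $p,q,r\in K$ and $a,b,c\in T$: $p+(q+r)=(p+q)+r$; $p+q=q+p$; $p;(q;r)=(p;q);r$; $p;1=1;p=p$; $p;(q+r)=p;q+p;r$; $(p+q);r=p;r+q;r$; $p;0=0;p=0$; $1+p;p^*=p^*$; $q+p;r\leq r\Rightarrow p^*;q\leq r$; $q+r;p\leq r\Rightarrow q;p^*\leq r$; $a;b\leq c\Leftrightarrow b\leq a\rightarrow c$; $a\leq 1$; $a;b=b;a$, where $p\leq q$ means $p+q=q$. An I-GKAT is a GKAT additionally satisfying $a;a=a$ for all $a\in T$. $M(n,K)$ is the set of $n\times n$ matrices with entries in $K$; $+$ is entrywise addition, $;$ is matrix multiplication $(A;B)_{ij}=\sum_k A_{ik};B_{kj}$ (using $+$ and $;$ of $\mathbf{A}$), $0_n$ the zero matrix, $I_n$ the identity matrix (1 on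 diagonal, 0 elsewhere). ${}^*$ on matrices is the standard Kleene-algebra matrix star: for $n=1$, $[a]^*=[a^*]$; for $n>1$, write $E=\begin{bmatrix}P&Q\\R&S\end{bmatrix}$ with $P$, $S$ square blocks, let $F=P+Q;S^*;R$, and set $E^*=\begin{bmatrix}F^*&F^*;Q;S^*\\S^*;R;F^*&S^*+S^*;R;F^*;Q;S^*\end{bmatrix}$. $\Delta(n,T)$ is the set of diagonal $n\times n$ matrices with diagonal entries in $T$, and for $A,B\in\Delta(n,T)$, $A\rightarrow B$ is the diagonal matrix with $(A\rightarrow B)_{ii}=A_{ii}\rightarrow B_{ii}$ and all off-diagonal entries $0$. -}

module Defs where

open import Level using (Level; _⊔_)
open import Data.Nat using (ℕ; zero; suc)
open import Data.Fin using (Fin; zero; suc)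
open import Data.Fin.Properties using (_≟_)
open import Data.Product using (_×_; _,_; proj₁; proj₂)
open import Relation.Nullary using (¬_; yes; no)
open import Relation.Binary.PropositionalEquality using (_≡_)
open import Relation.Binary.Structures using (IsEquivalence)

-- Signature of a GKAT over a setoid: carrier K with equality _≈_,
-- the set of tests T ⊆ K given as a predicate Test on K,
-- and the residual → defined on tests (taking test-membership witnesses).
record RawGKAT (c ℓ t : Level) : Set (Level.suc (c ⊔ ℓ ⊔ t)) where
  infixl 6 _+_
  infixl 7 _⨾_
  infix  4 _≈_
  field
    K    : Set c
    _≈_  : K → K → Set ℓ
    Test : K → Set t
    _+_  : K → K → K
    _⨾_  : K → K → K
    _⋆   : K → K
    imp  : (a b : K) → Test a → Test b → K
    0#   : K
    1#   : K

record IsGKAT {c ℓ t} (A : RawGKAT c ℓ t) : Set (c ⊔ ℓ ⊔ t) where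
  open RawGKAT A
  infix 4 _≤_
  _≤_ : K → K → Set ℓ
  p ≤ q = p + q ≈ q
  field
    isEquivalence : IsEquivalence _≈_
    +-cong   : ∀ {p p' q q'} → p ≈ p' → q ≈ q' → p + q ≈ p' + q'
    ⨾-cong   : ∀ {p p' q q'} → p ≈ p' → q ≈ q' → p ⨾ q ≈ p' ⨾ q'
    ⋆-cong   : ∀ {p p'} → p ≈ p' → p ⋆ ≈ p' ⋆
    Test-resp : ∀ {a b} → a ≈ b → Test a → Test b
    imp-cong : ∀ {a a' b b'} (ta : Test a) (ta' : Test a') (tb : Test b) (tb' : Test b') →
               a ≈ a' → b ≈ b' → imp a b ta tb ≈ imp a' b' ta' tb'
    Test-0   : Test 0#
    Test-1   : Test 1#
    Test-+   : ∀ {a b} → Test a → Test b → Test (a + b)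
    Test-⨾   : ∀ {a b} → Test a → Test b → Test (a ⨾ b)
    Test-imp : ∀ {a b} (ta : Test a) (tb : Test b) → Test (imp a b ta tb)
    +-assoc  : ∀ p q r → p + (q + r) ≈ (p + q) + r
    +-comm   : ∀ p q → p + q ≈ q + p
    ⨾-assoc  : ∀ p q r → p ⨾ (q ⨾ r) ≈ (p ⨾ q) ⨾ r
    ⨾-identityʳ : ∀ p → p ⨾ 1# ≈ p
    ⨾-identityˡ : ∀ p → 1# ⨾ p ≈ p
    distribˡ : ∀ p q r → p ⨾ (q + r) ≈ p ⨾ q + p ⨾ r
    distribʳ : ∀ p q r → (p + q) ⨾ r ≈ p ⨾ r + q ⨾ r
    zeroʳ    : ∀ p → p ⨾ 0# ≈ 0#
    zeroˡ    : ∀ p → 0# ⨾ p ≈ 0#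
    unfold   : ∀ p → 1# + p ⨾ (p ⋆) ≈ p ⋆
    inductionˡ : ∀ p q r → (q + p ⨾ r) ≤ r → ((p ⋆) ⨾ q) ≤ r
    inductionʳ : ∀ p q r → (q + r ⨾ p) ≤ r → (q ⨾ (p ⋆)) ≤ r
    residuation : ∀ a b c (ta : Test a) (tb : Test b) (tc : Test c) →
                  ((a ⨾ b) ≤ c → b ≤ imp a c ta tc) × (b ≤ imp a c ta tc → (a ⨾ b) ≤ c)
    test-≤1  : ∀ a → Test a → a ≤ 1#
    test-comm : ∀ a b → Test a → Test b → a ⨾ b ≈ b ⨾ a

record IsIGKAT {c ℓ t} (A : RawGKAT c ℓ t) : Set (c ⊔ ℓ ⊔ t) where
  open RawGKAT A
  field
    isGKAT : IsGKAT A
    test-idem : ∀ a → Test a → a ⨾ a ≈ a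

module Matrices {c ℓ t} (A : RawGKAT c ℓ t) where
  open RawGKAT A

  Mat : ℕ → ℕ → Set c
  Mat r s = Fin r → Fin s → K

  sumF : ∀ n → (Fin n → K) → K
  sumF zero    f = 0#
  sumF (suc n) f = f zero + sumF n (λ k → f (suc k))

  _⊕_ : ∀ {r s} → Mat r s → Mat r s → Mat r s
  (M ⊕ N) i j = M i j + N i j

  _⊗_ : ∀ {r m s} → Mat r m → Mat m s → Mat r s
  _⊗_ {m = m} M N i j = sumF m (λ k → M i k ⨾ N k j)

  zeroM : ∀ n → Mat n n
  zeroM n i j = 0#

  idM : ∀ n → Mat n n
  idM n i j with i ≟ j
  ... | yes _ = 1#
  ... | no  _ = 0#

  -- Block step of the matrix star for E of size (m+2)×(m+2), split as
  -- [[P, Q], [R, S]] with P of size 1×1 and S of size (m+1)×(m+1);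
  -- the argument S* is the (recursively computed) star of S.
  blockStar : ∀ m → Mat (suc m) (suc m) → Mat (suc (suc m)) (suc (suc m))
              → Mat (suc (suc m)) (suc (suc m))
  blockStar m S* E = assemble
    where
      P : Mat 1 1
      P _ _ = E zero zero
      Q : Mat 1 (suc m)
      Q _ j = E zero (suc j)
      R : Mat (suc m) 1
      R i _ = E (suc i) zero
      F : Mat 1 1
      F = P ⊕ ((Q ⊗ S*) ⊗ R)
      F* : Mat 1 1
      F* _ _ = (F zero zero) ⋆
      TR : Mat 1 (suc m)
      TR = (F* ⊗ Q) ⊗ S*
      BL : Mat (suc m) 1
      BL = (S* ⊗ R) ⊗ F*
      BR : Mat (suc m) (suc m)
      BR = S* ⊕ ((((S* ⊗ R) ⊗ F*) ⊗ Q) ⊗ S*)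
      assemble : Mat (suc (suc m)) (suc (suc m))
      assemble zero    zero    = F* zero zero
      assemble zero    (suc j) = TR zero j
      assemble (suc i) zero    = BL i zero
      assemble (suc i) (suc j) = BR i j

  starM : ∀ n → Mat n n → Mat n n
  starM zero          E = E
  starM (suc zero)    E = λ _ _ → (E zero zero) ⋆
  starM (suc (suc m)) E =
    blockStar m (starM (suc m) (λ i j → E (suc i) (suc j))) E

  IsDiag : ∀ n → Mat n n → Set (ℓ ⊔ t)
  IsDiag n M = (∀ i j → ¬ (i ≡ j) → M i j ≈ 0#) × (∀ i → Test (M i i))

  impM : ∀ n (M N : Mat n n) → IsDiag n M → IsDiag n N → Mat n n
  impM n M N dM dN i j with i ≟ j
  ... | yes _ = imp (M i i) (N i i) (proj₂ dM i) (proj₂ dN i)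
  ... | no  _ = 0#

  MatRaw : ℕ → RawGKAT c ℓ (ℓ ⊔ t)
  MatRaw n = record
    { K    = Mat n n
    ; _≈_  = λ M N → ∀ i j → M i j ≈ N i j
    ; Test = IsDiag n
    ; _+_  = _⊕_
    ; _⨾_  = _⊗_
    ; _⋆   = starM n
    ; imp  = impM n
    ; 0#   = zeroM n
    ; 1#   = idM n
    }

open Matrices public using (MatRaw)

-- The star is treated by induction on the size: writing
-- E = [[P, Q], [R, S]] with P of size 1×1, the unfolding law and both induction
-- laws for E⋆ follow blockwise from those for S⋆ and for the scalar star of
-- F = P + Q S⋆ R.  Diagonal matrices multiply entrywise along the diagonal, so
-- every test axiom, residuation included, reduces to the corresponding axiom of
-- A on each diagonal entry, off-diagonal entries being 0.
module Submission where

open import Defs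
open import Level using (Level; _⊔_)
open import Algebra.Bundles using (CommutativeSemigroup)
open import Algebra.Structures using (IsIdempotentSemiring)
import Algebra.Properties.CommutativeSemigroup as CommutativeSemigroupProperties
open import Data.Nat using (ℕ; zero; suc)
import Data.Nat as ℕ
open import Data.Fin using (Fin; zero; suc)
open import Data.Fin.Properties using (_≟_; suc-injective)
open import Data.Product using (_×_; _,_; proj₁; proj₂)
open import Data.Empty using (⊥-elim)
open import Function using (_∘_)
open import Relation.Nullary using (¬_; yes; no)
open import Relation.Binary.PropositionalEquality as ≡ using (_≡_)
open import Relation.Binary.Bundles using (Setoid; Poset)
open import Relation.Binary.Structures using (IsEquivalence; IsPartialOrder)
import Relation.Binary.Reasoning.Setoid as SetoidReasoning
import Relation.Binary.Reasoning.PartialOrder as PosetReasoning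

module GKATProperties {c ℓ t} {A : RawGKAT c ℓ t} (G : IsGKAT A) where
  open RawGKAT A
  open IsGKAT G
  open IsEquivalence isEquivalence

  setoid : Setoid c ℓ
  setoid = record { isEquivalence = isEquivalence }

  open SetoidReasoning setoid

  -- The axioms do not mention 0 + p = p or p + p = p; both come from
  -- 0 ≤ 1 and 1 ≤ 1 (tests lie below 1), multiplied on the left by p.
  ⨾-absorbs-≤1 : ∀ p a → a + 1# ≈ 1# → p ⨾ a + p ≈ p
  ⨾-absorbs-≤1 p a a≤1 = begin
    p ⨾ a + p        ≈⟨ +-cong refl (sym (⨾-identityʳ p)) ⟩
    p ⨾ a + p ⨾ 1#   ≈⟨ sym (distribˡ p a 1#) ⟩
    p ⨾ (a + 1#)     ≈⟨ ⨾-cong refl a≤1 ⟩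
    p ⨾ 1#           ≈⟨ ⨾-identityʳ p ⟩
    p                ∎

  +-identityˡ : ∀ p → 0# + p ≈ p
  +-identityˡ p = trans (+-cong (sym (zeroʳ p)) refl) (⨾-absorbs-≤1 p 0# (test-≤1 0# Test-0))

  +-identityʳ : ∀ p → p + 0# ≈ p
  +-identityʳ p = trans (+-comm p 0#) (+-identityˡ p)

  +-idem : ∀ p → p + p ≈ p
  +-idem p = trans (+-cong (sym (⨾-identityʳ p)) refl) (⨾-absorbs-≤1 p 1# (test-≤1 1# Test-1))

  isIdempotentSemiring : IsIdempotentSemiring _≈_ _+_ _⨾_ 0# 1#
  isIdempotentSemiring = record
    { isSemiring = record
      { isSemiringWithoutAnnihilatingZero = record
        { +-isCommutativeMonoid = record
          { isMonoid = record
            { isSemigroup = record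
              { isMagma = record { isEquivalence = isEquivalence ; ∙-cong = +-cong }
              ; assoc = λ p q r → sym (+-assoc p q r)
              }
            ; identity = +-identityˡ , +-identityʳ
            }
          ; comm = +-comm
          }
        ; *-cong = ⨾-cong
        ; *-assoc = λ p q r → sym (⨾-assoc p q r)
        ; *-identity = ⨾-identityˡ , ⨾-identityʳ
        ; distrib = distribˡ , λ r p q → distribʳ p q r
        }
      ; zero = zeroˡ , zeroʳ
      }
    ; +-idem = +-idem
    }

module MatrixSemiring {c ℓ t} (A : RawGKAT c ℓ t)
  (isIdempotentSemiring : IsIdempotentSemiring (RawGKAT._≈_ A) (RawGKAT._+_ A)
                            (RawGKAT._⨾_ A) (RawGKAT.0# A) (RawGKAT.1# A)) where
  open RawGKAT A
  open Matrices A public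
  open IsIdempotentSemiring isIdempotentSemiring hiding (zero)
    renaming (refl to ≈-refl; sym to ≈-sym; trans to ≈-trans; *-cong to ⨾-cong)

  private
    +-commutativeSemigroup : CommutativeSemigroup c ℓ
    +-commutativeSemigroup = record { isCommutativeSemigroup = +-isCommutativeSemigroup }

    module +-Properties = CommutativeSemigroupProperties +-commutativeSemigroup

  sumF-cong : ∀ n {f g : Fin n → K} → (∀ k → f k ≈ g k) → sumF n f ≈ sumF n g
  sumF-cong zero    f≈g = ≈-refl
  sumF-cong (suc n) f≈g = +-cong (f≈g zero) (sumF-cong n (λ k → f≈g (suc k)))

  sumF-zero : ∀ n {f : Fin n → K} → (∀ k → f k ≈ 0#) → sumF n f ≈ 0#
  sumF-zero zero    f≈0 = ≈-refl
  sumF-zero (suc n) f≈0 =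
    ≈-trans (+-cong (f≈0 zero) (sumF-zero n (λ k → f≈0 (suc k)))) (+-identityˡ 0#)

  sumF-distrib-+ : ∀ n (f g : Fin n → K) →
                   sumF n (λ k → f k + g k) ≈ sumF n f + sumF n g
  sumF-distrib-+ zero    f g = ≈-sym (+-identityˡ 0#)
  sumF-distrib-+ (suc n) f g =
    ≈-trans (+-cong ≈-refl (sumF-distrib-+ n (λ k → f (suc k)) (λ k → g (suc k))))
            (+-Properties.interchange (f zero) (g zero) _ _)

  ⨾-distribˡ-sumF : ∀ n p (f : Fin n → K) → p ⨾ sumF n f ≈ sumF n (λ k → p ⨾ f k)
  ⨾-distribˡ-sumF zero    p f = zeroʳ p
  ⨾-distribˡ-sumF (suc n) p f =
    ≈-trans (distribˡ p _ _) (+-cong ≈-refl (⨾-distribˡ-sumF n p (λ k → f (suc k))))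

  ⨾-distribʳ-sumF : ∀ n p (f : Fin n → K) → sumF n f ⨾ p ≈ sumF n (λ k → f k ⨾ p)
  ⨾-distribʳ-sumF zero    p f = zeroˡ p
  ⨾-distribʳ-sumF (suc n) p f =
    ≈-trans (distribʳ p _ _) (+-cong ≈-refl (⨾-distribʳ-sumF n p (λ k → f (suc k))))

  sumF-comm : ∀ m n (f : Fin m → Fin n → K) →
              sumF m (λ i → sumF n (f i)) ≈ sumF n (λ j → sumF m (λ i → f i j))
  sumF-comm zero    n f = ≈-sym (sumF-zero n (λ _ → ≈-refl))
  sumF-comm (suc m) n f =
    ≈-trans (+-cong ≈-refl (sumF-comm m n (λ i → f (suc i))))
            (≈-sym (sumF-distrib-+ n (f zero) (λ j → sumF m (λ i → f (suc i) j))))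

  sumF-single : ∀ n (f : Fin n → K) i → (∀ k → ¬ k ≡ i → f k ≈ 0#) → sumF n f ≈ f i
  sumF-single (suc n) f zero    f≈0 =
    ≈-trans (+-cong ≈-refl (sumF-zero n (λ k → f≈0 (suc k) (λ ())))) (+-identityʳ (f zero))
  sumF-single (suc n) f (suc i) f≈0 =
    ≈-trans (+-cong (f≈0 zero (λ ()))
                    (sumF-single n (λ k → f (suc k)) i (λ k k≢i → f≈0 (suc k) (k≢i ∘ suc-injective))))
            (+-identityˡ (f (suc i)))

  idM-diag : ∀ n (i : Fin n) → idM n i i ≈ 1#
  idM-diag n i with i ≟ i
  ... | yes _  = ≈-refl
  ... | no i≢i = ⊥-elim (i≢i ≡.refl)

  idM-offdiag : ∀ n {i j : Fin n} → ¬ i ≡ j → idM n i j ≈ 0#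
  idM-offdiag n {i} {j} i≢j with i ≟ j
  ... | yes i≡j = ⊥-elim (i≢j i≡j)
  ... | no _    = ≈-refl

  idM-suc : ∀ n (i j : Fin n) → idM (suc n) (suc i) (suc j) ≈ idM n i j
  idM-suc n i j with i ≟ j
  ... | yes _ = ≈-refl
  ... | no  _ = ≈-refl

  infix 4 _≋_
  record _≋_ {r s} (X Y : Mat r s) : Set ℓ where
    constructor mk≋
    field entry : ∀ i j → X i j ≈ Y i j
  open _≋_ public

  ≋-isEquivalence : ∀ {r s} → IsEquivalence (_≋_ {r} {s})
  ≋-isEquivalence = record
    { refl  = mk≋ λ i j → ≈-refl
    ; sym   = λ X≋Y → mk≋ λ i j → ≈-sym (entry X≋Y i j)
    ; trans = λ X≋Y Y≋Z → mk≋ λ i j → ≈-trans (entry X≋Y i j) (entry Y≋Z i j)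
    }

  ≋-setoid : ℕ → ℕ → Setoid c ℓ
  ≋-setoid r s = record { isEquivalence = ≋-isEquivalence {r} {s} }

  module _ {r s : ℕ} where
    open IsEquivalence (≋-isEquivalence {r} {s}) public
      renaming (refl to ≋-refl; sym to ≋-sym; trans to ≋-trans)

  ⊕-cong : ∀ {r s} {X X' Y Y' : Mat r s} → X ≋ X' → Y ≋ Y' → X ⊕ Y ≋ X' ⊕ Y'
  ⊕-cong X≋X' Y≋Y' = mk≋ λ i j → +-cong (entry X≋X' i j) (entry Y≋Y' i j)

  ⊕-congˡ : ∀ {r s} (X : Mat r s) {Y Y' : Mat r s} → Y ≋ Y' → X ⊕ Y ≋ X ⊕ Y'
  ⊕-congˡ X = ⊕-cong ≋-refl

  ⊕-identityˡ : ∀ {r s} (X : Mat r s) → (λ _ _ → 0#) ⊕ X ≋ X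
  ⊕-identityˡ X = mk≋ λ i j → +-identityˡ (X i j)

  ⊕-idem : ∀ {r s} (X : Mat r s) → X ⊕ X ≋ X
  ⊕-idem X = mk≋ λ i j → +-idem (X i j)

  ⊕-commutativeSemigroup : ℕ → ℕ → CommutativeSemigroup c ℓ
  ⊕-commutativeSemigroup r s = record
    { _≈_ = _≋_ {r} {s}
    ; _∙_ = _⊕_
    ; isCommutativeSemigroup = record
      { isSemigroup = record
        { isMagma = record { isEquivalence = ≋-isEquivalence ; ∙-cong = ⊕-cong }
        ; assoc   = λ X Y Z → mk≋ λ i j → +-assoc (X i j) (Y i j) (Z i j)
        }
      ; comm = λ X Y → mk≋ λ i j → +-comm (X i j) (Y i j)
      }
    }

  module _ {r s : ℕ} where
    open CommutativeSemigroup (⊕-commutativeSemigroup r s) public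
      using () renaming (assoc to ⊕-assoc; comm to ⊕-comm)
    open CommutativeSemigroupProperties (⊕-commutativeSemigroup r s) public
      using () renaming (interchange to ⊕-interchange; x∙yz≈y∙xz to x⊕yz≋y⊕xz)

  ⊗-cong : ∀ {r m s} {X X' : Mat r m} {Y Y' : Mat m s} → X ≋ X' → Y ≋ Y' → X ⊗ Y ≋ X' ⊗ Y'
  ⊗-cong {m = m} X≋X' Y≋Y' =
    mk≋ λ i j → sumF-cong m (λ k → ⨾-cong (entry X≋X' i k) (entry Y≋Y' k j))

  ⊗-congˡ : ∀ {r m s} (X : Mat r m) {Y Y' : Mat m s} → Y ≋ Y' → X ⊗ Y ≋ X ⊗ Y'
  ⊗-congˡ X = ⊗-cong ≋-refl

  ⊗-congʳ : ∀ {r m s} (Y : Mat m s) {X X' : Mat r m} → X ≋ X' → X ⊗ Y ≋ X' ⊗ Y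
  ⊗-congʳ Y X≋X' = ⊗-cong X≋X' ≋-refl

  ⊗-assoc : ∀ {r m n s} (X : Mat r m) (Y : Mat m n) (Z : Mat n s) →
            (X ⊗ Y) ⊗ Z ≋ X ⊗ (Y ⊗ Z)
  ⊗-assoc {m = m} {n} X Y Z = mk≋ λ i j → begin
    sumF n (λ k → sumF m (λ l → X i l ⨾ Y l k) ⨾ Z k j)
      ≈⟨ sumF-cong n (λ k → ⨾-distribʳ-sumF m (Z k j) _) ⟩
    sumF n (λ k → sumF m (λ l → (X i l ⨾ Y l k) ⨾ Z k j))
      ≈⟨ sumF-comm n m _ ⟩
    sumF m (λ l → sumF n (λ k → (X i l ⨾ Y l k) ⨾ Z k j))
      ≈⟨ sumF-cong m (λ l → sumF-cong n (λ k → *-assoc _ _ _)) ⟩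
    sumF m (λ l → sumF n (λ k → X i l ⨾ (Y l k ⨾ Z k j)))
      ≈⟨ sumF-cong m (λ l → ≈-sym (⨾-distribˡ-sumF n (X i l) _)) ⟩
    sumF m (λ l → X i l ⨾ sumF n (λ k → Y l k ⨾ Z k j)) ∎
    where open SetoidReasoning setoid

  ⊗-assoc₄ : ∀ {r m n p s} (W : Mat r m) (X : Mat m n) (Y : Mat n p) (Z : Mat p s) →
             ((W ⊗ X) ⊗ Y) ⊗ Z ≋ W ⊗ (X ⊗ (Y ⊗ Z))
  ⊗-assoc₄ W X Y Z = ≋-trans (⊗-assoc (W ⊗ X) Y Z) (⊗-assoc W X (Y ⊗ Z))

  ⊗-distribˡ : ∀ {r m s} (X : Mat r m) (Y Z : Mat m s) → X ⊗ (Y ⊕ Z) ≋ (X ⊗ Y) ⊕ (X ⊗ Z)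
  ⊗-distribˡ {m = m} X Y Z =
    mk≋ λ i j → ≈-trans (sumF-cong m (λ k → distribˡ _ _ _)) (sumF-distrib-+ m _ _)

  ⊗-distribʳ : ∀ {r m s} (X Y : Mat r m) (Z : Mat m s) → (X ⊕ Y) ⊗ Z ≋ (X ⊗ Z) ⊕ (Y ⊗ Z)
  ⊗-distribʳ {m = m} X Y Z =
    mk≋ λ i j → ≈-trans (sumF-cong m (λ k → distribʳ _ _ _)) (sumF-distrib-+ m _ _)

  ⊗-zeroˡ : ∀ {r m s} (X : Mat m s) → (λ _ _ → 0#) ⊗ X ≋ (λ (_ : Fin r) (_ : Fin s) → 0#)
  ⊗-zeroˡ {m = m} X = mk≋ λ i j → sumF-zero m (λ k → zeroˡ _)

  ⊗-zeroʳ : ∀ {r m s} (X : Mat r m) → X ⊗ (λ _ _ → 0#) ≋ (λ (_ : Fin r) (_ : Fin s) → 0#)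
  ⊗-zeroʳ {m = m} X = mk≋ λ i j → sumF-zero m (λ k → zeroʳ _)

  ⊗-identityˡ : ∀ {n s} (X : Mat n s) → idM n ⊗ X ≋ X
  ⊗-identityˡ {n} X = mk≋ λ i j →
    ≈-trans (sumF-single n _ i (λ k k≢i →
               ≈-trans (⨾-cong (idM-offdiag n (k≢i ∘ ≡.sym)) ≈-refl) (zeroˡ _)))
            (≈-trans (⨾-cong (idM-diag n i) ≈-refl) (*-identityˡ _))

  ⊗-identityʳ : ∀ {r n} (X : Mat r n) → X ⊗ idM n ≋ X
  ⊗-identityʳ {n = n} X = mk≋ λ i j →
    ≈-trans (sumF-single n _ j (λ k k≢j →
               ≈-trans (⨾-cong ≈-refl (idM-offdiag n k≢j)) (zeroʳ _)))
            (≈-trans (⨾-cong ≈-refl (idM-diag n j)) (*-identityʳ _))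

  infix 4 _≤_
  record _≤_ {r s} (X Y : Mat r s) : Set ℓ where
    constructor mk≤
    field absorb : X ⊕ Y ≋ Y
  open _≤_ public

  ≤-isPartialOrder : ∀ {r s} → IsPartialOrder (_≋_ {r} {s}) _≤_
  ≤-isPartialOrder = record
    { isPreorder = record
      { isEquivalence = ≋-isEquivalence
      ; reflexive = λ {X} {Y} X≋Y → mk≤ (≋-trans (⊕-cong X≋Y ≋-refl) (⊕-idem Y))
      ; trans = λ {X} {Y} {Z} (mk≤ X⊕Y≋Y) (mk≤ Y⊕Z≋Z) → mk≤ (begin
          X ⊕ Z          ≈⟨ ⊕-congˡ X (≋-sym Y⊕Z≋Z) ⟩
          X ⊕ (Y ⊕ Z)    ≈⟨ ≋-sym (⊕-assoc X Y Z) ⟩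
          (X ⊕ Y) ⊕ Z    ≈⟨ ⊕-cong X⊕Y≋Y ≋-refl ⟩
          Y ⊕ Z          ≈⟨ Y⊕Z≋Z ⟩
          Z              ∎)
      }
    ; antisym = λ {X} {Y} (mk≤ X⊕Y≋Y) (mk≤ Y⊕X≋X) →
        ≋-trans (≋-sym Y⊕X≋X) (≋-trans (⊕-comm Y X) X⊕Y≋Y)
    }
    where open SetoidReasoning (≋-setoid _ _)

  ≤-poset : ℕ → ℕ → Poset c ℓ ℓ
  ≤-poset r s = record { isPartialOrder = ≤-isPartialOrder {r} {s} }

  module _ {r s : ℕ} where
    open IsPartialOrder (≤-isPartialOrder {r} {s}) public
      using () renaming (reflexive to ≋⇒≤; trans to ≤-trans; antisym to ≤-antisym)

  ≤-refl : ∀ {r s} {X : Mat r s} → X ≤ X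
  ≤-refl = ≋⇒≤ ≋-refl

  ⊕-mono-≤ : ∀ {r s} {X X' Y Y' : Mat r s} → X ≤ X' → Y ≤ Y' → X ⊕ Y ≤ X' ⊕ Y'
  ⊕-mono-≤ (mk≤ X⊕X'≋X') (mk≤ Y⊕Y'≋Y') =
    mk≤ (≋-trans (⊕-interchange _ _ _ _) (⊕-cong X⊕X'≋X' Y⊕Y'≋Y'))

  ⊕-monoˡ-≤ : ∀ {r s} (X : Mat r s) {Y Y' : Mat r s} → Y ≤ Y' → X ⊕ Y ≤ X ⊕ Y'
  ⊕-monoˡ-≤ X = ⊕-mono-≤ ≤-refl

  ⊗-monoˡ-≤ : ∀ {r m s} (X : Mat r m) {Y Y' : Mat m s} → Y ≤ Y' → X ⊗ Y ≤ X ⊗ Y'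
  ⊗-monoˡ-≤ X (mk≤ Y⊕Y'≋Y') = mk≤ (≋-trans (≋-sym (⊗-distribˡ X _ _)) (⊗-congˡ X Y⊕Y'≋Y'))

  ⊗-monoʳ-≤ : ∀ {r m s} (Y : Mat m s) {X X' : Mat r m} → X ≤ X' → X ⊗ Y ≤ X' ⊗ Y
  ⊗-monoʳ-≤ Y (mk≤ X⊕X'≋X') = mk≤ (≋-trans (≋-sym (⊗-distribʳ _ _ Y)) (⊗-congʳ Y X⊕X'≋X'))

  top : ∀ {r s} → Mat (suc r) s → Mat 1 s
  top X _ j = X zero j

  bottom : ∀ {r s} → Mat (suc r) s → Mat r s
  bottom X i j = X (suc i) j

  left : ∀ {r s} → Mat r (suc s) → Mat r 1
  left X i _ = X i zero

  right : ∀ {r s} → Mat r (suc s) → Mat r s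
  right X i j = X i (suc j)

  top-mono-≤ : ∀ {r s} {X Y : Mat (suc r) s} → X ≤ Y → top X ≤ top Y
  top-mono-≤ (mk≤ X⊕Y≋Y) = mk≤ (mk≋ λ _ j → entry X⊕Y≋Y zero j)

  bottom-mono-≤ : ∀ {r s} {X Y : Mat (suc r) s} → X ≤ Y → bottom X ≤ bottom Y
  bottom-mono-≤ (mk≤ X⊕Y≋Y) = mk≤ (mk≋ λ i j → entry X⊕Y≋Y (suc i) j)

  left-mono-≤ : ∀ {r s} {X Y : Mat r (suc s)} → X ≤ Y → left X ≤ left Y
  left-mono-≤ (mk≤ X⊕Y≋Y) = mk≤ (mk≋ λ i _ → entry X⊕Y≋Y i zero)

  right-mono-≤ : ∀ {r s} {X Y : Mat r (suc s)} → X ≤ Y → right X ≤ right Y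
  right-mono-≤ (mk≤ X⊕Y≋Y) = mk≤ (mk≋ λ i j → entry X⊕Y≋Y i (suc j))

  ≋-byRows : ∀ {r s} {X Y : Mat (suc r) s} → top X ≋ top Y → bottom X ≋ bottom Y → X ≋ Y
  ≋-byRows top≋ bottom≋ = mk≋ λ { zero j → entry top≋ zero j ; (suc i) j → entry bottom≋ i j }

  ≋-byColumns : ∀ {r s} {X Y : Mat r (suc s)} → left X ≋ left Y → right X ≋ right Y → X ≋ Y
  ≋-byColumns left≋ right≋ = mk≋ λ { i zero → entry left≋ i zero ; i (suc j) → entry right≋ i j }

  ≤-byRows : ∀ {r s} {X Y : Mat (suc r) s} → top X ≤ top Y → bottom X ≤ bottom Y → X ≤ Y
  ≤-byRows (mk≤ top≋) (mk≤ bottom≋) = mk≤ (≋-byRows top≋ bottom≋)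

  ≤-byColumns : ∀ {r s} {X Y : Mat r (suc s)} → left X ≤ left Y → right X ≤ right Y → X ≤ Y
  ≤-byColumns (mk≤ left≋) (mk≤ right≋) = mk≤ (≋-byColumns left≋ right≋)

  idM-top-left : ∀ n → top (left (idM (suc n))) ≋ idM 1
  idM-top-left n = mk≋ λ { zero zero → ≈-refl }

  idM-bottom-right : ∀ n → bottom (right (idM (suc n))) ≋ idM n
  idM-bottom-right n = mk≋ (idM-suc n)

  ⊗-split : ∀ {r m s} (X : Mat r (suc m)) (Y : Mat (suc m) s) →
            X ⊗ Y ≋ (left X ⊗ top Y) ⊕ (right X ⊗ bottom Y)
  ⊗-split X Y = mk≋ λ i j → +-cong (≈-sym (+-identityʳ _)) ≈-refl

module MatrixStar {c ℓ t} {A : RawGKAT c ℓ t} (G : IsGKAT A) where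
  open RawGKAT A
  open IsGKAT G using (unfold; inductionˡ; inductionʳ)
  open GKATProperties G using (isIdempotentSemiring)
  open MatrixSemiring A isIdempotentSemiring
  open IsIdempotentSemiring isIdempotentSemiring using (+-cong; +-identityʳ)
    renaming (refl to ≈-refl; sym to ≈-sym; trans to ≈-trans)

  StarUnfolds : ∀ n → Mat n n → Set ℓ
  StarUnfolds n E = idM n ⊕ (E ⊗ starM n E) ≋ starM n E

  StarInductsˡ : ∀ n → Mat n n → Set (c ⊔ ℓ)
  StarInductsˡ n E = ∀ k (Y Z : Mat n k) → Y ⊕ (E ⊗ Z) ≤ Z → starM n E ⊗ Y ≤ Z

  StarInductsʳ : ∀ n → Mat n n → Set (c ⊔ ℓ)
  StarInductsʳ n E = ∀ k (Y Z : Mat k n) → Y ⊕ (Z ⊗ E) ≤ Z → Y ⊗ starM n E ≤ Z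

  unfolds-⊗ʳ : ∀ {n s} (X : Mat n n) → StarUnfolds n X →
               ∀ (Y : Mat n s) → Y ⊕ ((X ⊗ starM n X) ⊗ Y) ≋ starM n X ⊗ Y
  unfolds-⊗ʳ {n} X unfold Y = begin
    Y ⊕ ((X ⊗ X⋆) ⊗ Y)                ≈⟨ ⊕-cong (≋-sym (⊗-identityˡ Y)) ≋-refl ⟩
    (idM n ⊗ Y) ⊕ ((X ⊗ X⋆) ⊗ Y)      ≈⟨ ≋-sym (⊗-distribʳ (idM n) (X ⊗ X⋆) Y) ⟩
    (idM n ⊕ (X ⊗ X⋆)) ⊗ Y            ≈⟨ ⊗-congʳ Y unfold ⟩
    X⋆ ⊗ Y                            ∎
    where
      open SetoidReasoning (≋-setoid _ _)
      X⋆ : Mat n n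
      X⋆ = starM n X

  unfold₁ : (E : Mat 1 1) → StarUnfolds 1 E
  unfold₁ E = mk≋ λ { zero zero → ≈-trans (+-cong ≈-refl (+-identityʳ _)) (unfold (E zero zero)) }

  inductionˡ₁ : (E : Mat 1 1) → StarInductsˡ 1 E
  inductionˡ₁ E k Y Z (mk≤ H) = mk≤ (mk≋ λ { zero j →
    ≈-trans (+-cong (+-identityʳ _) ≈-refl)
      (inductionˡ (E zero zero) (Y zero j) (Z zero j)
        (≈-trans (+-cong (+-cong ≈-refl (≈-sym (+-identityʳ _))) ≈-refl) (entry H zero j))) })

  inductionʳ₁ : (E : Mat 1 1) → StarInductsʳ 1 E
  inductionʳ₁ E k Y Z (mk≤ H) = mk≤ (mk≋ λ { i zero →
    ≈-trans (+-cong (+-identityʳ _) ≈-refl)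
      (inductionʳ (E zero zero) (Y i zero) (Z i zero)
        (≈-trans (+-cong (+-cong ≈-refl (≈-sym (+-identityʳ _))) ≈-refl) (entry H i zero))) })

  module Block (m : ℕ) (E : Mat (suc (suc m)) (suc (suc m))) where
    P : Mat 1 1
    P = top (left E)
    Q : Mat 1 (suc m)
    Q = top (right E)
    R : Mat (suc m) 1
    R = bottom (left E)
    S : Mat (suc m) (suc m)
    S = bottom (right E)

    S⋆ : Mat (suc m) (suc m)
    S⋆ = starM (suc m) S
    F : Mat 1 1
    F = P ⊕ ((Q ⊗ S⋆) ⊗ R)
    F⋆ : Mat 1 1
    F⋆ = starM 1 F

    E⋆ : Mat (suc (suc m)) (suc (suc m))
    E⋆ = starM (suc (suc m)) E

    -- By definition of starM, E⋆ has top-left block F⋆ and the following three blocks.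
    E⋆₁₂ : Mat 1 (suc m)
    E⋆₁₂ = (F⋆ ⊗ Q) ⊗ S⋆
    E⋆₂₁ : Mat (suc m) 1
    E⋆₂₁ = (S⋆ ⊗ R) ⊗ F⋆
    E⋆₂₂ : Mat (suc m) (suc m)
    E⋆₂₂ = S⋆ ⊕ ((E⋆₂₁ ⊗ Q) ⊗ S⋆)

    ⊗-E⋆₂₁ : ∀ {r} (X : Mat r (suc m)) → X ⊗ E⋆₂₁ ≋ ((X ⊗ S⋆) ⊗ R) ⊗ F⋆
    ⊗-E⋆₂₁ X = ≋-sym (≋-trans (⊗-assoc (X ⊗ S⋆) R F⋆)
                              (≋-trans (⊗-assoc X S⋆ (R ⊗ F⋆)) (⊗-congˡ X (≋-sym (⊗-assoc S⋆ R F⋆)))))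

    E⋆₂₂-tail : (E⋆₂₁ ⊗ Q) ⊗ S⋆ ≋ S⋆ ⊗ (R ⊗ E⋆₁₂)
    E⋆₂₂-tail = begin
      (((S⋆ ⊗ R) ⊗ F⋆) ⊗ Q) ⊗ S⋆      ≈⟨ ⊗-assoc ((S⋆ ⊗ R) ⊗ F⋆) Q S⋆ ⟩
      ((S⋆ ⊗ R) ⊗ F⋆) ⊗ (Q ⊗ S⋆)      ≈⟨ ⊗-assoc (S⋆ ⊗ R) F⋆ (Q ⊗ S⋆) ⟩
      (S⋆ ⊗ R) ⊗ (F⋆ ⊗ (Q ⊗ S⋆))      ≈⟨ ⊗-assoc S⋆ R (F⋆ ⊗ (Q ⊗ S⋆)) ⟩
      S⋆ ⊗ (R ⊗ (F⋆ ⊗ (Q ⊗ S⋆)))      ≈⟨ ⊗-congˡ S⋆ (⊗-congˡ R (≋-sym (⊗-assoc F⋆ Q S⋆))) ⟩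
      S⋆ ⊗ (R ⊗ E⋆₁₂)                 ∎
      where open SetoidReasoning (≋-setoid _ _)

    first-row-by-F⋆ : (P ⊗ F⋆) ⊕ (Q ⊗ E⋆₂₁) ≋ F ⊗ F⋆
    first-row-by-F⋆ = ≋-trans (⊕-congˡ (P ⊗ F⋆) (⊗-E⋆₂₁ Q)) (≋-sym (⊗-distribʳ P ((Q ⊗ S⋆) ⊗ R) F⋆))

    module _ (S-unfolds : StarUnfolds (suc m) S) where

      unfold-top-left : idM 1 ⊕ (top E ⊗ left E⋆) ≋ F⋆
      unfold-top-left = begin
        idM 1 ⊕ (top E ⊗ left E⋆)               ≈⟨ ⊕-congˡ (idM 1) (⊗-split (top E) (left E⋆)) ⟩
        idM 1 ⊕ ((P ⊗ F⋆) ⊕ (Q ⊗ E⋆₂₁))         ≈⟨ ⊕-congˡ (idM 1) first-row-by-F⋆ ⟩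
        idM 1 ⊕ (F ⊗ F⋆)                        ≈⟨ unfold₁ F ⟩
        F⋆                                      ∎
        where open SetoidReasoning (≋-setoid _ _)

      unfold-top-right : top E ⊗ right E⋆ ≋ E⋆₁₂
      unfold-top-right = begin
        top E ⊗ right E⋆                          ≈⟨ ⊗-split (top E) (right E⋆) ⟩
        (P ⊗ E⋆₁₂) ⊕ (Q ⊗ E⋆₂₂)                   ≈⟨ ⊕-cong (⊗-congˡ P (⊗-assoc F⋆ Q S⋆))
                                                             (⊗-distribˡ Q S⋆ ((E⋆₂₁ ⊗ Q) ⊗ S⋆)) ⟩
        (P ⊗ (F⋆ ⊗ W)) ⊕ (W ⊕ (Q ⊗ ((E⋆₂₁ ⊗ Q) ⊗ S⋆)))
                                                  ≈⟨ ⊕-cong (≋-sym (⊗-assoc P F⋆ W))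
                                                       (⊕-congˡ W (≋-trans (⊗-congˡ Q (⊗-assoc E⋆₂₁ Q S⋆))
                                                                           (≋-sym (⊗-assoc Q E⋆₂₁ W)))) ⟩
        ((P ⊗ F⋆) ⊗ W) ⊕ (W ⊕ ((Q ⊗ E⋆₂₁) ⊗ W))   ≈⟨ x⊕yz≋y⊕xz _ W _ ⟩
        W ⊕ (((P ⊗ F⋆) ⊗ W) ⊕ ((Q ⊗ E⋆₂₁) ⊗ W))   ≈⟨ ⊕-congˡ W (≋-sym (⊗-distribʳ (P ⊗ F⋆) (Q ⊗ E⋆₂₁) W)) ⟩
        W ⊕ (((P ⊗ F⋆) ⊕ (Q ⊗ E⋆₂₁)) ⊗ W)         ≈⟨ ⊕-congˡ W (⊗-congʳ W first-row-by-F⋆) ⟩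
        W ⊕ ((F ⊗ F⋆) ⊗ W)                        ≈⟨ unfolds-⊗ʳ F (unfold₁ F) W ⟩
        F⋆ ⊗ W                                    ≈⟨ ≋-sym (⊗-assoc F⋆ Q S⋆) ⟩
        E⋆₁₂                                      ∎
        where
          open SetoidReasoning (≋-setoid _ _)
          W : Mat 1 (suc m)
          W = Q ⊗ S⋆

      unfold-bottom-left : bottom E ⊗ left E⋆ ≋ E⋆₂₁
      unfold-bottom-left = begin
        bottom E ⊗ left E⋆                      ≈⟨ ⊗-split (bottom E) (left E⋆) ⟩
        (R ⊗ F⋆) ⊕ (S ⊗ E⋆₂₁)                   ≈⟨ ⊕-congˡ (R ⊗ F⋆)
                                                     (≋-trans (⊗-congˡ S (⊗-assoc S⋆ R F⋆))
                                                              (≋-sym (⊗-assoc S S⋆ (R ⊗ F⋆)))) ⟩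
        (R ⊗ F⋆) ⊕ ((S ⊗ S⋆) ⊗ (R ⊗ F⋆))        ≈⟨ unfolds-⊗ʳ S S-unfolds (R ⊗ F⋆) ⟩
        S⋆ ⊗ (R ⊗ F⋆)                           ≈⟨ ≋-sym (⊗-assoc S⋆ R F⋆) ⟩
        E⋆₂₁                                    ∎
        where open SetoidReasoning (≋-setoid _ _)

      unfold-bottom-right : idM (suc m) ⊕ (bottom E ⊗ right E⋆) ≋ E⋆₂₂
      unfold-bottom-right = begin
        I ⊕ (bottom E ⊗ right E⋆)                 ≈⟨ ⊕-congˡ I (⊗-split (bottom E) (right E⋆)) ⟩
        I ⊕ (V ⊕ (S ⊗ E⋆₂₂))                      ≈⟨ ⊕-congˡ I (⊕-congˡ V (≋-trans (⊗-distribˡ S S⋆ ((E⋆₂₁ ⊗ Q) ⊗ S⋆))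
                                                       (⊕-congˡ (S ⊗ S⋆) (≋-trans (⊗-congˡ S E⋆₂₂-tail)
                                                         (≋-sym (⊗-assoc S S⋆ V)))))) ⟩
        I ⊕ (V ⊕ ((S ⊗ S⋆) ⊕ ((S ⊗ S⋆) ⊗ V)))     ≈⟨ ⊕-congˡ I (x⊕yz≋y⊕xz V (S ⊗ S⋆) _) ⟩
        I ⊕ ((S ⊗ S⋆) ⊕ (V ⊕ ((S ⊗ S⋆) ⊗ V)))     ≈⟨ ≋-sym (⊕-assoc I (S ⊗ S⋆) _) ⟩
        (I ⊕ (S ⊗ S⋆)) ⊕ (V ⊕ ((S ⊗ S⋆) ⊗ V))     ≈⟨ ⊕-cong S-unfolds (unfolds-⊗ʳ S S-unfolds V) ⟩
        S⋆ ⊕ (S⋆ ⊗ V)                             ≈⟨ ⊕-congˡ S⋆ (≋-sym E⋆₂₂-tail) ⟩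
        E⋆₂₂                                      ∎
        where
          open SetoidReasoning (≋-setoid _ _)
          I : Mat (suc m) (suc m)
          I = idM (suc m)
          V : Mat (suc m) (suc m)
          V = R ⊗ E⋆₁₂

      unfolds : StarUnfolds (suc (suc m)) E
      unfolds = ≋-byRows
        (≋-byColumns (≋-trans (⊕-cong (idM-top-left (suc m)) ≋-refl) unfold-top-left)
                     (≋-trans (⊕-identityˡ _) unfold-top-right))
        (≋-byColumns (≋-trans (⊕-identityˡ _) unfold-bottom-left)
                     (≋-trans (⊕-cong (idM-bottom-right (suc m)) ≋-refl) unfold-bottom-right))

    inductsˡ : StarInductsˡ (suc m) S → StarInductsˡ (suc (suc m)) E
    inductsˡ S-inductsˡ k Y Z Y⊕EZ≤Z = ≤-byRows top-bound bottom-bound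
      where
        y₀ = top Y
        y₁ = bottom Y
        z₀ = top Z
        z₁ = bottom Z

        top-hyp : y₀ ⊕ ((P ⊗ z₀) ⊕ (Q ⊗ z₁)) ≤ z₀
        top-hyp = ≤-trans (≋⇒≤ (⊕-congˡ y₀ (≋-sym (⊗-split (top E) Z)))) (top-mono-≤ Y⊕EZ≤Z)

        bottom-hyp : y₁ ⊕ ((R ⊗ z₀) ⊕ (S ⊗ z₁)) ≤ z₁
        bottom-hyp = ≤-trans (≋⇒≤ (⊕-congˡ y₁ (≋-sym (⊗-split (bottom E) Z)))) (bottom-mono-≤ Y⊕EZ≤Z)

        S⋆-bound : S⋆ ⊗ (y₁ ⊕ (R ⊗ z₀)) ≤ z₁
        S⋆-bound = S-inductsˡ k (y₁ ⊕ (R ⊗ z₀)) z₁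
          (≤-trans (≋⇒≤ (⊕-assoc y₁ (R ⊗ z₀) (S ⊗ z₁))) bottom-hyp)

        w : Mat 1 k
        w = y₀ ⊕ (Q ⊗ (S⋆ ⊗ y₁))

        F⋆-bound : F⋆ ⊗ w ≤ z₀
        F⋆-bound = inductionˡ₁ F k w z₀ (begin
          w ⊕ (F ⊗ z₀)
            ≈⟨ ⊕-congˡ w (≋-trans (⊗-distribʳ P ((Q ⊗ S⋆) ⊗ R) z₀)
                                  (⊕-congˡ (P ⊗ z₀) (⊗-assoc₄ Q S⋆ R z₀))) ⟩
          (y₀ ⊕ (Q ⊗ (S⋆ ⊗ y₁))) ⊕ ((P ⊗ z₀) ⊕ (Q ⊗ (S⋆ ⊗ (R ⊗ z₀))))
            ≈⟨ ≋-trans (⊕-interchange _ _ _ _) (⊕-assoc _ _ _) ⟩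
          y₀ ⊕ ((P ⊗ z₀) ⊕ ((Q ⊗ (S⋆ ⊗ y₁)) ⊕ (Q ⊗ (S⋆ ⊗ (R ⊗ z₀)))))
            ≈⟨ ⊕-congˡ y₀ (⊕-congˡ (P ⊗ z₀) (≋-trans (≋-sym (⊗-distribˡ Q (S⋆ ⊗ y₁) (S⋆ ⊗ (R ⊗ z₀))))
                                                      (⊗-congˡ Q (≋-sym (⊗-distribˡ S⋆ y₁ (R ⊗ z₀)))))) ⟩
          y₀ ⊕ ((P ⊗ z₀) ⊕ (Q ⊗ (S⋆ ⊗ (y₁ ⊕ (R ⊗ z₀)))))
            ≤⟨ ⊕-monoˡ-≤ y₀ (⊕-monoˡ-≤ (P ⊗ z₀) (⊗-monoˡ-≤ Q S⋆-bound)) ⟩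
          y₀ ⊕ ((P ⊗ z₀) ⊕ (Q ⊗ z₁))
            ≤⟨ top-hyp ⟩
          z₀ ∎)
          where open PosetReasoning (≤-poset _ _)

        top-bound : top E⋆ ⊗ Y ≤ z₀
        top-bound = begin
          top E⋆ ⊗ Y                    ≈⟨ ⊗-split (top E⋆) Y ⟩
          (F⋆ ⊗ y₀) ⊕ (E⋆₁₂ ⊗ y₁)       ≈⟨ ⊕-congˡ (F⋆ ⊗ y₀) (⊗-assoc₄ F⋆ Q S⋆ y₁) ⟩
          (F⋆ ⊗ y₀) ⊕ (F⋆ ⊗ (Q ⊗ (S⋆ ⊗ y₁)))
                                        ≈⟨ ≋-sym (⊗-distribˡ F⋆ y₀ (Q ⊗ (S⋆ ⊗ y₁))) ⟩
          F⋆ ⊗ w                        ≤⟨ F⋆-bound ⟩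
          z₀                            ∎
          where open PosetReasoning (≤-poset _ _)

        bottom-bound : bottom E⋆ ⊗ Y ≤ z₁
        bottom-bound = begin
          bottom E⋆ ⊗ Y
            ≈⟨ ≋-trans (⊗-split (bottom E⋆) Y) (⊕-congˡ (E⋆₂₁ ⊗ y₀) (⊗-distribʳ S⋆ ((E⋆₂₁ ⊗ Q) ⊗ S⋆) y₁)) ⟩
          (E⋆₂₁ ⊗ y₀) ⊕ ((S⋆ ⊗ y₁) ⊕ (((E⋆₂₁ ⊗ Q) ⊗ S⋆) ⊗ y₁))
            ≈⟨ x⊕yz≋y⊕xz _ (S⋆ ⊗ y₁) _ ⟩
          (S⋆ ⊗ y₁) ⊕ ((E⋆₂₁ ⊗ y₀) ⊕ (((E⋆₂₁ ⊗ Q) ⊗ S⋆) ⊗ y₁))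
            ≈⟨ ⊕-congˡ (S⋆ ⊗ y₁) (≋-trans (⊕-congˡ (E⋆₂₁ ⊗ y₀) (⊗-assoc₄ E⋆₂₁ Q S⋆ y₁))
                                          (≋-sym (⊗-distribˡ E⋆₂₁ y₀ (Q ⊗ (S⋆ ⊗ y₁))))) ⟩
          (S⋆ ⊗ y₁) ⊕ (E⋆₂₁ ⊗ w)
            ≈⟨ ⊕-congˡ (S⋆ ⊗ y₁) (⊗-assoc (S⋆ ⊗ R) F⋆ w) ⟩
          (S⋆ ⊗ y₁) ⊕ ((S⋆ ⊗ R) ⊗ (F⋆ ⊗ w))
            ≤⟨ ⊕-monoˡ-≤ (S⋆ ⊗ y₁) (⊗-monoˡ-≤ (S⋆ ⊗ R) F⋆-bound) ⟩
          (S⋆ ⊗ y₁) ⊕ ((S⋆ ⊗ R) ⊗ z₀)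
            ≈⟨ ⊕-congˡ (S⋆ ⊗ y₁) (⊗-assoc S⋆ R z₀) ⟩
          (S⋆ ⊗ y₁) ⊕ (S⋆ ⊗ (R ⊗ z₀))
            ≈⟨ ≋-sym (⊗-distribˡ S⋆ y₁ (R ⊗ z₀)) ⟩
          S⋆ ⊗ (y₁ ⊕ (R ⊗ z₀))
            ≤⟨ S⋆-bound ⟩
          z₁ ∎
          where open PosetReasoning (≤-poset _ _)

    inductsʳ : StarInductsʳ (suc m) S → StarInductsʳ (suc (suc m)) E
    inductsʳ S-inductsʳ k Y Z Y⊕ZE≤Z = ≤-byColumns left-bound right-bound
      where
        y₀ = left Y
        y₁ = right Y
        z₀ = left Z
        z₁ = right Z

        left-hyp : y₀ ⊕ ((z₀ ⊗ P) ⊕ (z₁ ⊗ R)) ≤ z₀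
        left-hyp = ≤-trans (≋⇒≤ (⊕-congˡ y₀ (≋-sym (⊗-split Z (left E))))) (left-mono-≤ Y⊕ZE≤Z)

        right-hyp : y₁ ⊕ ((z₀ ⊗ Q) ⊕ (z₁ ⊗ S)) ≤ z₁
        right-hyp = ≤-trans (≋⇒≤ (⊕-congˡ y₁ (≋-sym (⊗-split Z (right E))))) (right-mono-≤ Y⊕ZE≤Z)

        S⋆-bound : (y₁ ⊕ (z₀ ⊗ Q)) ⊗ S⋆ ≤ z₁
        S⋆-bound = S-inductsʳ k (y₁ ⊕ (z₀ ⊗ Q)) z₁
          (≤-trans (≋⇒≤ (⊕-assoc y₁ (z₀ ⊗ Q) (z₁ ⊗ S))) right-hyp)

        w : Mat k 1
        w = y₀ ⊕ ((y₁ ⊗ S⋆) ⊗ R)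

        F⋆-bound : w ⊗ F⋆ ≤ z₀
        F⋆-bound = inductionʳ₁ F k w z₀ (begin
          w ⊕ (z₀ ⊗ F)
            ≈⟨ ⊕-congˡ w (≋-trans (⊗-distribˡ z₀ P ((Q ⊗ S⋆) ⊗ R))
                 (⊕-congˡ (z₀ ⊗ P) (≋-trans (⊗-congˡ z₀ (⊗-assoc Q S⋆ R))
                                            (≋-sym (⊗-assoc₄ z₀ Q S⋆ R))))) ⟩
          (y₀ ⊕ ((y₁ ⊗ S⋆) ⊗ R)) ⊕ ((z₀ ⊗ P) ⊕ (((z₀ ⊗ Q) ⊗ S⋆) ⊗ R))
            ≈⟨ ≋-trans (⊕-interchange _ _ _ _) (⊕-assoc _ _ _) ⟩
          y₀ ⊕ ((z₀ ⊗ P) ⊕ (((y₁ ⊗ S⋆) ⊗ R) ⊕ (((z₀ ⊗ Q) ⊗ S⋆) ⊗ R)))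
            ≈⟨ ⊕-congˡ y₀ (⊕-congˡ (z₀ ⊗ P)
                 (≋-trans (≋-sym (⊗-distribʳ (y₁ ⊗ S⋆) ((z₀ ⊗ Q) ⊗ S⋆) R))
                          (⊗-congʳ R (≋-sym (⊗-distribʳ y₁ (z₀ ⊗ Q) S⋆))))) ⟩
          y₀ ⊕ ((z₀ ⊗ P) ⊕ (((y₁ ⊕ (z₀ ⊗ Q)) ⊗ S⋆) ⊗ R))
            ≤⟨ ⊕-monoˡ-≤ y₀ (⊕-monoˡ-≤ (z₀ ⊗ P) (⊗-monoʳ-≤ R S⋆-bound)) ⟩
          y₀ ⊕ ((z₀ ⊗ P) ⊕ (z₁ ⊗ R))
            ≤⟨ left-hyp ⟩
          z₀ ∎)
          where open PosetReasoning (≤-poset _ _)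

        Y⊗left-E⋆ : Y ⊗ left E⋆ ≋ w ⊗ F⋆
        Y⊗left-E⋆ = begin
          Y ⊗ left E⋆                                 ≈⟨ ⊗-split Y (left E⋆) ⟩
          (y₀ ⊗ F⋆) ⊕ (y₁ ⊗ E⋆₂₁)                     ≈⟨ ⊕-congˡ (y₀ ⊗ F⋆) (⊗-E⋆₂₁ y₁) ⟩
          (y₀ ⊗ F⋆) ⊕ (((y₁ ⊗ S⋆) ⊗ R) ⊗ F⋆)          ≈⟨ ≋-sym (⊗-distribʳ y₀ ((y₁ ⊗ S⋆) ⊗ R) F⋆) ⟩
          w ⊗ F⋆                                      ∎
          where open SetoidReasoning (≋-setoid _ _)

        left-bound : Y ⊗ left E⋆ ≤ z₀
        left-bound = ≤-trans (≋⇒≤ Y⊗left-E⋆) F⋆-bound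

        right-bound : Y ⊗ right E⋆ ≤ z₁
        right-bound = begin
          Y ⊗ right E⋆
            ≈⟨ ≋-trans (⊗-split Y (right E⋆)) (⊕-congˡ (y₀ ⊗ E⋆₁₂) (⊗-distribˡ y₁ S⋆ ((E⋆₂₁ ⊗ Q) ⊗ S⋆))) ⟩
          (y₀ ⊗ E⋆₁₂) ⊕ ((y₁ ⊗ S⋆) ⊕ (y₁ ⊗ ((E⋆₂₁ ⊗ Q) ⊗ S⋆)))
            ≈⟨ x⊕yz≋y⊕xz (y₀ ⊗ E⋆₁₂) (y₁ ⊗ S⋆) _ ⟩
          (y₁ ⊗ S⋆) ⊕ ((y₀ ⊗ ((F⋆ ⊗ Q) ⊗ S⋆)) ⊕ (y₁ ⊗ ((E⋆₂₁ ⊗ Q) ⊗ S⋆)))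
            ≈⟨ ⊕-congˡ (y₁ ⊗ S⋆) (⊕-cong (⊗-reassoc y₀ F⋆) (⊗-reassoc y₁ E⋆₂₁)) ⟩
          (y₁ ⊗ S⋆) ⊕ ((((y₀ ⊗ F⋆) ⊗ Q) ⊗ S⋆) ⊕ (((y₁ ⊗ E⋆₂₁) ⊗ Q) ⊗ S⋆))
            ≈⟨ ⊕-congˡ (y₁ ⊗ S⋆) (≋-trans (≋-sym (⊗-distribʳ ((y₀ ⊗ F⋆) ⊗ Q) ((y₁ ⊗ E⋆₂₁) ⊗ Q) S⋆))
                 (⊗-congʳ S⋆ (≋-sym (⊗-distribʳ (y₀ ⊗ F⋆) (y₁ ⊗ E⋆₂₁) Q)))) ⟩
          (y₁ ⊗ S⋆) ⊕ ((((y₀ ⊗ F⋆) ⊕ (y₁ ⊗ E⋆₂₁)) ⊗ Q) ⊗ S⋆)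
            ≈⟨ ⊕-congˡ (y₁ ⊗ S⋆) (⊗-congʳ S⋆ (⊗-congʳ Q
                 (≋-trans (≋-sym (⊗-split Y (left E⋆))) Y⊗left-E⋆))) ⟩
          (y₁ ⊗ S⋆) ⊕ (((w ⊗ F⋆) ⊗ Q) ⊗ S⋆)
            ≤⟨ ⊕-monoˡ-≤ (y₁ ⊗ S⋆) (⊗-monoʳ-≤ S⋆ (⊗-monoʳ-≤ Q F⋆-bound)) ⟩
          (y₁ ⊗ S⋆) ⊕ ((z₀ ⊗ Q) ⊗ S⋆)
            ≈⟨ ≋-sym (⊗-distribʳ y₁ (z₀ ⊗ Q) S⋆) ⟩
          (y₁ ⊕ (z₀ ⊗ Q)) ⊗ S⋆
            ≤⟨ S⋆-bound ⟩
          z₁ ∎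
          where
            open PosetReasoning (≤-poset _ _)
            ⊗-reassoc : ∀ {n} (X : Mat k n) (B : Mat n 1) →
                        X ⊗ ((B ⊗ Q) ⊗ S⋆) ≋ ((X ⊗ B) ⊗ Q) ⊗ S⋆
            ⊗-reassoc X B = ≋-trans (⊗-congˡ X (⊗-assoc B Q S⋆)) (≋-sym (⊗-assoc₄ X B Q S⋆))

  starM-unfolds : ∀ n (E : Mat n n) → StarUnfolds n E
  starM-unfolds zero          E = mk≋ λ ()
  starM-unfolds (suc zero)    E = unfold₁ E
  starM-unfolds (suc (suc m)) E = Block.unfolds m E (starM-unfolds (suc m) (Block.S m E))

  starM-inductsˡ : ∀ n (E : Mat n n) → StarInductsˡ n E
  starM-inductsˡ zero          E k Y Z _ = mk≤ (mk≋ λ ())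
  starM-inductsˡ (suc zero)    E       = inductionˡ₁ E
  starM-inductsˡ (suc (suc m)) E       = Block.inductsˡ m E (starM-inductsˡ (suc m) (Block.S m E))

  starM-inductsʳ : ∀ n (E : Mat n n) → StarInductsʳ n E
  starM-inductsʳ zero          E k Y Z _ = mk≤ (mk≋ λ _ ())
  starM-inductsʳ (suc zero)    E       = inductionʳ₁ E
  starM-inductsʳ (suc (suc m)) E       = Block.inductsʳ m E (starM-inductsʳ (suc m) (Block.S m E))

  starM-mono : ∀ n {E E' : Mat n n} → E ≤ E' → starM n E ≤ starM n E'
  starM-mono n {E} {E'} E≤E' = begin
    starM n E                       ≈⟨ ≋-sym (⊗-identityʳ (starM n E)) ⟩
    starM n E ⊗ idM n               ≤⟨ starM-inductsˡ n E n (idM n) (starM n E') (begin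
      idM n ⊕ (E ⊗ starM n E')          ≤⟨ ⊕-monoˡ-≤ (idM n) (⊗-monoʳ-≤ (starM n E') E≤E') ⟩
      idM n ⊕ (E' ⊗ starM n E')         ≈⟨ starM-unfolds n E' ⟩
      starM n E'                        ∎) ⟩
    starM n E'                      ∎
    where open PosetReasoning (≤-poset _ _)

  starM-cong : ∀ n {E E' : Mat n n} → E ≋ E' → starM n E ≋ starM n E'
  starM-cong n E≋E' = ≤-antisym (starM-mono n (≋⇒≤ E≋E')) (starM-mono n (≋⇒≤ (≋-sym E≋E')))

module DiagonalTests {c ℓ t} {A : RawGKAT c ℓ t} (G : IsGKAT A) (n : ℕ) where
  open RawGKAT A
  open IsGKAT G hiding (_≤_)
  open GKATProperties G using (isIdempotentSemiring; +-identityˡ; +-identityʳ)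
  open MatrixSemiring A isIdempotentSemiring
  open IsEquivalence isEquivalence renaming (refl to ≈-refl; sym to ≈-sym; trans to ≈-trans)

  diag-⊗ : ∀ {D} → IsDiag n D → ∀ (X : Mat n n) i j → (D ⊗ X) i j ≈ D i i ⨾ X i j
  diag-⊗ (D-offdiag , _) X i j =
    sumF-single n _ i (λ k k≢i → ≈-trans (⨾-cong (D-offdiag i k (k≢i ∘ ≡.sym)) ≈-refl) (zeroˡ _))

  diag-⊗-offdiag : ∀ {D D'} → IsDiag n D → IsDiag n D' → ∀ {i j} → ¬ i ≡ j → (D ⊗ D') i j ≈ 0#
  diag-⊗-offdiag {D' = D'} dD (D'-offdiag , _) {i} {j} i≢j =
    ≈-trans (diag-⊗ dD D' i j) (≈-trans (⨾-cong ≈-refl (D'-offdiag i j i≢j)) (zeroʳ _))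

  impM-diag : ∀ {D D'} (dD : IsDiag n D) (dD' : IsDiag n D') i →
              impM n D D' dD dD' i i ≈ imp (D i i) (D' i i) (proj₂ dD i) (proj₂ dD' i)
  impM-diag dD dD' i with i ≟ i
  ... | yes _  = ≈-refl
  ... | no i≢i = ⊥-elim (i≢i ≡.refl)

  impM-offdiag : ∀ {D D'} (dD : IsDiag n D) (dD' : IsDiag n D') {i j} → ¬ i ≡ j →
                 impM n D D' dD dD' i j ≈ 0#
  impM-offdiag dD dD' {i} {j} i≢j with i ≟ j
  ... | yes i≡j = ⊥-elim (i≢j i≡j)
  ... | no _    = ≈-refl

  isDiag-resp : ∀ {D D'} → D ≋ D' → IsDiag n D → IsDiag n D'
  isDiag-resp (mk≋ D≈D') (D-offdiag , D-tests) =
    (λ i j i≢j → ≈-trans (≈-sym (D≈D' i j)) (D-offdiag i j i≢j)) ,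
    (λ i → Test-resp (D≈D' i i) (D-tests i))

  isDiag-zeroM : IsDiag n (zeroM n)
  isDiag-zeroM = (λ _ _ _ → ≈-refl) , (λ _ → Test-0)

  isDiag-idM : IsDiag n (idM n)
  isDiag-idM = (λ _ _ → idM-offdiag n) , (λ i → Test-resp (≈-sym (idM-diag n i)) Test-1)

  isDiag-⊕ : ∀ {D D'} → IsDiag n D → IsDiag n D' → IsDiag n (D ⊕ D')
  isDiag-⊕ (D-offdiag , D-tests) (D'-offdiag , D'-tests) =
    (λ i j i≢j → ≈-trans (+-cong (D-offdiag i j i≢j) (D'-offdiag i j i≢j)) (+-identityˡ 0#)) ,
    (λ i → Test-+ (D-tests i) (D'-tests i))

  isDiag-⊗ : ∀ {D D'} → IsDiag n D → IsDiag n D' → IsDiag n (D ⊗ D')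
  isDiag-⊗ {D' = D'} dD dD' =
    (λ i j → diag-⊗-offdiag dD dD') ,
    (λ i → Test-resp (≈-sym (diag-⊗ dD D' i i)) (Test-⨾ (proj₂ dD i) (proj₂ dD' i)))

  isDiag-impM : ∀ {D D'} (dD : IsDiag n D) (dD' : IsDiag n D') → IsDiag n (impM n D D' dD dD')
  isDiag-impM dD dD' =
    (λ i j → impM-offdiag dD dD') ,
    (λ i → Test-resp (≈-sym (impM-diag dD dD' i)) (Test-imp (proj₂ dD i) (proj₂ dD' i)))

  impM-cong : ∀ {D₁ D₂ D₁' D₂'} (d₁ : IsDiag n D₁) (d₁' : IsDiag n D₁') (d₂ : IsDiag n D₂)
              (d₂' : IsDiag n D₂') → D₁ ≋ D₁' → D₂ ≋ D₂' →
              impM n D₁ D₂ d₁ d₂ ≋ impM n D₁' D₂' d₁' d₂'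
  impM-cong d₁ d₁' d₂ d₂' (mk≋ D₁≈D₁') (mk≋ D₂≈D₂') = mk≋ entrywise
    where
      entrywise : ∀ i j → impM n _ _ d₁ d₂ i j ≈ impM n _ _ d₁' d₂' i j
      entrywise i j with i ≟ j
      ... | yes _ = imp-cong _ _ _ _ (D₁≈D₁' i i) (D₂≈D₂' i i)
      ... | no  _ = ≈-refl

  impM-residuation : ∀ {D₁ D₂ D₃} (d₁ : IsDiag n D₁) (d₂ : IsDiag n D₂) (d₃ : IsDiag n D₃) →
                     (D₁ ⊗ D₂ ≤ D₃ → D₂ ≤ impM n D₁ D₃ d₁ d₃) ×
                     (D₂ ≤ impM n D₁ D₃ d₁ d₃ → D₁ ⊗ D₂ ≤ D₃)
  impM-residuation {D₁} {D₂} {D₃} d₁ d₂ d₃ = residuate , unresiduate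
    where
      residuate : D₁ ⊗ D₂ ≤ D₃ → D₂ ≤ impM n D₁ D₃ d₁ d₃
      residuate (mk≤ (mk≋ D₁D₂≤D₃)) = mk≤ (mk≋ entrywise)
        where
          entrywise : ∀ i j → D₂ i j + impM n D₁ D₃ d₁ d₃ i j ≈ impM n D₁ D₃ d₁ d₃ i j
          entrywise i j with i ≟ j
          ... | yes ≡.refl = proj₁ (residuation _ _ _ (proj₂ d₁ i) (proj₂ d₂ i) (proj₂ d₃ i))
                  (≈-trans (+-cong (≈-sym (diag-⊗ d₁ D₂ i i)) ≈-refl) (D₁D₂≤D₃ i i))
          ... | no i≢j     = ≈-trans (+-identityʳ _) (proj₁ d₂ i j i≢j)

      unresiduate : D₂ ≤ impM n D₁ D₃ d₁ d₃ → D₁ ⊗ D₂ ≤ D₃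
      unresiduate (mk≤ (mk≋ D₂≤D₁→D₃)) = mk≤ (mk≋ entrywise)
        where
          entrywise : ∀ i j → (D₁ ⊗ D₂) i j + D₃ i j ≈ D₃ i j
          entrywise i j with i ≟ j
          ... | yes ≡.refl = ≈-trans (+-cong (diag-⊗ d₁ D₂ i i) ≈-refl)
                  (proj₂ (residuation _ _ _ (proj₂ d₁ i) (proj₂ d₂ i) (proj₂ d₃ i))
                    (≈-trans (+-cong ≈-refl (≈-sym (impM-diag d₁ d₃ i)))
                             (≈-trans (D₂≤D₁→D₃ i i) (impM-diag d₁ d₃ i))))
          ... | no i≢j     = ≈-trans (+-cong (diag-⊗-offdiag d₁ d₂ i≢j) ≈-refl) (+-identityˡ _)

  isDiag-≤-idM : ∀ {D} → IsDiag n D → D ≤ idM n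
  isDiag-≤-idM {D} (D-offdiag , D-tests) = mk≤ (mk≋ entrywise)
    where
      entrywise : ∀ i j → D i j + idM n i j ≈ idM n i j
      entrywise i j with i ≟ j
      ... | yes ≡.refl = test-≤1 (D i i) (D-tests i)
      ... | no i≢j     = ≈-trans (+-cong (D-offdiag i j i≢j) ≈-refl) (+-identityˡ _)

  isDiag-⊗-comm : ∀ {D D'} → IsDiag n D → IsDiag n D' → D ⊗ D' ≋ D' ⊗ D
  isDiag-⊗-comm {D} {D'} d d' = mk≋ entrywise
    where
      entrywise : ∀ i j → (D ⊗ D') i j ≈ (D' ⊗ D) i j
      entrywise i j with i ≟ j
      ... | yes ≡.refl = ≈-trans (diag-⊗ d D' i i)
              (≈-trans (test-comm (D i i) (D' i i) (proj₂ d i) (proj₂ d' i)) (≈-sym (diag-⊗ d' D i i)))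
      ... | no i≢j     = ≈-trans (diag-⊗-offdiag d d' i≢j) (≈-sym (diag-⊗-offdiag d' d i≢j))

  isDiag-⊗-idem : (∀ a → Test a → a ⨾ a ≈ a) → ∀ {D} → IsDiag n D → D ⊗ D ≋ D
  isDiag-⊗-idem test-idem {D} d = mk≋ entrywise
    where
      entrywise : ∀ i j → (D ⊗ D) i j ≈ D i j
      entrywise i j with i ≟ j
      ... | yes ≡.refl = ≈-trans (diag-⊗ d D i i) (test-idem (D i i) (proj₂ d i))
      ... | no i≢j     = ≈-trans (diag-⊗-offdiag d d i≢j) (≈-sym (proj₁ d i j i≢j))

isGKAT-MatRaw : ∀ {c ℓ t} {A : RawGKAT c ℓ t} → IsGKAT A → ∀ n → IsGKAT (MatRaw A n)
isGKAT-MatRaw {A = A} G n = record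
  { isEquivalence = record
    { refl  = entry ≋-refl
    ; sym   = λ X≈Y → entry (≋-sym (mk≋ X≈Y))
    ; trans = λ X≈Y Y≈Z → entry (≋-trans (mk≋ X≈Y) (mk≋ Y≈Z))
    }
  ; +-cong      = λ X≈X' Y≈Y' → entry (⊕-cong (mk≋ X≈X') (mk≋ Y≈Y'))
  ; ⨾-cong      = λ X≈X' Y≈Y' → entry (⊗-cong (mk≋ X≈X') (mk≋ Y≈Y'))
  ; ⋆-cong      = λ X≈X' → entry (starM-cong n (mk≋ X≈X'))
  ; Test-resp   = λ X≈Y → isDiag-resp (mk≋ X≈Y)
  ; imp-cong    = λ d₁ d₁' d₂ d₂' D₁≈D₁' D₂≈D₂' → entry (impM-cong d₁ d₁' d₂ d₂' (mk≋ D₁≈D₁') (mk≋ D₂≈D₂'))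
  ; Test-0      = isDiag-zeroM
  ; Test-1      = isDiag-idM
  ; Test-+      = isDiag-⊕
  ; Test-⨾      = isDiag-⊗
  ; Test-imp    = isDiag-impM
  ; +-assoc     = λ X Y Z → entry (≋-sym (⊕-assoc X Y Z))
  ; +-comm      = λ X Y → entry (⊕-comm X Y)
  ; ⨾-assoc     = λ X Y Z → entry (≋-sym (⊗-assoc X Y Z))
  ; ⨾-identityʳ = λ X → entry (⊗-identityʳ X)
  ; ⨾-identityˡ = λ X → entry (⊗-identityˡ X)
  ; distribˡ    = λ X Y Z → entry (⊗-distribˡ X Y Z)
  ; distribʳ    = λ X Y Z → entry (⊗-distribʳ X Y Z)
  ; zeroʳ       = λ X → entry (⊗-zeroʳ X)
  ; zeroˡ       = λ X → entry (⊗-zeroˡ X)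
  ; unfold      = λ E → entry (starM-unfolds n E)
  ; inductionˡ  = λ E Y Z EZ≤Z → entry (absorb (starM-inductsˡ n E n Y Z (mk≤ (mk≋ EZ≤Z))))
  ; inductionʳ  = λ E Y Z ZE≤Z → entry (absorb (starM-inductsʳ n E n Y Z (mk≤ (mk≋ ZE≤Z))))
  ; residuation = λ D₁ D₂ D₃ d₁ d₂ d₃ →
      (λ h → entry (absorb (proj₁ (impM-residuation d₁ d₂ d₃) (mk≤ (mk≋ h))))) ,
      (λ h → entry (absorb (proj₂ (impM-residuation d₁ d₂ d₃) (mk≤ (mk≋ h)))))
  ; test-≤1     = λ D d → entry (absorb (isDiag-≤-idM d))
  ; test-comm   = λ D D' d d' → entry (isDiag-⊗-comm d d')
  }
  where
    open GKATProperties G using (isIdempotentSemiring)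
    open MatrixSemiring A isIdempotentSemiring
    open MatrixStar G
    open DiagonalTests G n

isIGKAT-MatRaw : ∀ {c ℓ t} {A : RawGKAT c ℓ t} → IsIGKAT A → ∀ n → IsIGKAT (MatRaw A n)
isIGKAT-MatRaw {A = A} IG n = record
  { isGKAT    = isGKAT-MatRaw isGKAT n
  ; test-idem = λ D d → entry (isDiag-⊗-idem test-idem d)
  }
  where
    open IsIGKAT IG
    open GKATProperties isGKAT using (isIdempotentSemiring)
    open MatrixSemiring A isIdempotentSemiring using (entry)
    open DiagonalTests isGKAT n using (isDiag-⊗-idem)

theorem6 : ∀ {c ℓ t : Level} (A : RawGKAT c ℓ t) (n : ℕ) → 1 ℕ.≤ n →
           (IsGKAT A → IsGKAT (MatRaw A n)) × (IsIGKAT A → IsIGKAT (MatRaw A n))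
theorem6 A n _ = (λ G → isGKAT-MatRaw G n) , (λ IG → isIGKAT-MatRaw IG n)
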